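{- Let $n\ge 4$ and $m\ge 2$. Then: (i) if $(n,m)\ne(4,4)$, there is an optimal decision $k$ at board state $(n,m)$ with $k>1$; (ii) if $m\le 4$, the decision $\mathcal{S}(n,m)$ is optimal at board state $(n,m)$, where $\mathcal{S}(n,m)=0$ if $m=1$, $\mathcal{S}(4,4)=1$, $\mathcal{S}(6,4)=3$, $\mathcal{S}(10,4)=5$, and otherwise $\mathcal{S}(n,m)=n_<:=\left\lfloor \frac{n}{4}\right\rfloor+\left\lfloor\frac{n+1}{4}\right\rfloor$; (iii) for each $k\in\{4,6,10\}$ and every integer $N\ge 2k$, one has $P([k:N-k],4)\le P([N_<:N_>],4)$, where $N_<:=\left\lfloor \frac{N}{4}\right\rfloor+\left\lfloor\frac{N+1}{4}\right\rfloor$ and $N_>:=N-N_<$.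
   Context: Bipartite Guess Who is the following two-player zero-sum game of chance. A board state $(n,m)$ (with integers $n,m\ge 1$) means: the player to move has $n$ remaining suspects, one of which (uniformly at random) is the opponent's mystery person, and the opponent has $m$ remaining suspects. At board state $(n,m)$ the player to move chooses a decision: either the decision $0$ ("guess"), which ends the game and wins for the mover with probability $1/n$ and loses otherwise; or an integer $k$ with $1\le k\le n/2$, after which, with probability $k/n$, it becomes the opponent's turn at board state $(m,k)$, and with probability $(n-k)/n$, at board state $(m,n-k)$. Let $P(n,m)$ denote the probability that the player to move at $(n,m)$ wins when both play optimally: $$P(n,m)=\max\Big(\tfrac1n,\ \max_{1\le k\le n/2}\Big(1-\tfrac{k}{n}P(m,k)-\tfrac{n-k}{n}P(m,n-k)\Big)\Big),$$ with the inner maximum omitted when $n=1$. A decision is optimal if it attains this maximum. For positive integers $a,b$ and $m$ we write $P([a:b],m):=\frac{a}{a+b}P(a,m)+\frac{b}{a+b}P(b,m)$. -}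

module Defs where

open import Data.Nat as ℕ using (ℕ; zero; suc; _+_; _∸_; _≤_)
open import Data.Integer using (+_)
open import Data.Rational using (ℚ; 0ℚ; 1ℚ; _⊔_) renaming (_+_ to _+ℚ_; _*_ to _*ℚ_; _-_ to _-ℚ_)
import Data.Rational as Q
open import Data.List using (List; map; foldr; upTo)
open import Data.Product using (_×_)
open import Data.Sum using (_⊎_)
open import Relation.Binary.PropositionalEquality using (_≡_)

-- frac k n = k / n as a rational (0 when n = 0; never used with n = 0)
frac : ℕ → ℕ → ℚ
frac k zero = 0ℚ
frac k (suc n) = (+ k) Q./ suc n

decisions : ℕ → List ℕ
decisions n = map suc (upTo (n ℕ./ 2))

-- Fuel-indexed version of P.  The recursion (n,m) ↦ (m,k),(m,n-k) strictly
-- decreases n+m, so fuel n+m suffices (see P below).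
Pf : ℕ → ℕ → ℕ → ℚ
Pf zero _ _ = 0ℚ
Pf (suc f) zero m = 0ℚ
Pf (suc f) (suc n) m =
  foldr _⊔_ (frac 1 (suc n))
    (map (λ k → (1ℚ -ℚ (frac k (suc n) *ℚ Pf f m k))
                   -ℚ (frac (suc n ∸ k) (suc n) *ℚ Pf f m (suc n ∸ k)))
         (decisions (suc n)))

-- P(n,m): winning probability of the mover at board state (n,m) (n,m ≥ 1)
P : ℕ → ℕ → ℚ
P n m = Pf (n + m) n m

val : ℕ → ℕ → ℕ → ℚ
val n m k = (1ℚ -ℚ (frac k n *ℚ P m k)) -ℚ (frac (n ∸ k) n *ℚ P m (n ∸ k))

Optimal : ℕ → ℕ → ℕ → Set
Optimal n m d =
  (d ≡ 0 × P n m ≡ frac 1 n) ⊎ (1 ≤ d × d ≤ n ℕ./ 2 × P n m ≡ val n m d)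

Pmix : ℕ → ℕ → ℕ → ℚ
Pmix a b m = (frac a (a + b) *ℚ P a m) +ℚ (frac b (a + b) *ℚ P b m)

nlt : ℕ → ℕ
nlt n = n ℕ./ 4 + suc n ℕ./ 4

S : ℕ → ℕ → ℕ
S n 1 = 0
S 4 4 = 1
S 6 4 = 3
S 10 4 = 5
S n m = nlt n

{-# OPTIONS --safe #-}
module Submission where

-- Splitting n suspects into k and n − k is worth
--   val n m k = 1 − mean k (n − k) (P m k) (P m (n − k)),
-- where mean a b x y averages a copies of x with b copies of y.
-- A joint induction on n + m shows that P is nonincreasing in the mover's count and
-- nondecreasing in the opponent's: passing from n to n + 1 suspects moves weight in this
-- mean towards the larger value of P m.
-- For m ≤ 4 the rows k ↦ P m k have the form 1 − D k / (12 k) with D bounded by some c and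
-- equal to c from some t on. Then val n m k = (D k + D (n − k)) / (12 n), so any split into
-- two parts of size at least t, such as n_<, is optimal and the column n ↦ P n m is
-- 2c / (12 n); these columns determine the next row. The finitely many smaller boards are
-- evaluated.
-- For m ≥ 5, splitting off 2 suspects beats both guessing and splitting off 1 as soon as
-- P m (n − 1) ≥ 3/m, which follows from monotonicity and the column m = 3.
-- Part (iii) reduces, through P n 4 = R₄ n / (12 n), to an inequality between values of R₄.

open import Defs
open import Data.Nat using (ℕ; _≤_; _<_; _*_; _∸_)
open import Data.Rational using () renaming (_≤_ to _≤ℚ_)
open import Data.Product using (_×_; ∃-syntax)
open import Data.Sum using (_⊎_)
open import Relation.Nullary using (¬_)
open import Relation.Binary.PropositionalEquality using (_≡_)

open import Data.Nat as ℕ using (zero; suc; _+_; z≤n; s≤s; _≤?_; _<?_)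
import Data.Nat.Properties as ℕₚ
open import Data.Nat.Properties using (allUpTo?)
open import Data.Nat.DivMod using (m/n*n≤m; m*n/n≡m; /-monoˡ-≤; m/n≡1+[m∸n]/n)
open import Data.Nat.Tactic.RingSolver using () renaming (solve to ℕ-solve)
open import Data.Integer as ℤ using (+_)
import Data.Integer.Properties as ℤₚ
open import Data.Rational as ℚ using (ℚ; 0ℚ; 1ℚ; _⊔_; toℚᵘ)
import Data.Rational.Properties as ℚₚ
import Data.Rational.Unnormalised as ℚᵘ
import Data.Rational.Unnormalised.Properties as ℚᵘₚ
open import Data.Rational.Solver using (module +-*-Solver)
open import Data.List using ([]; _∷_; map; foldr)
open import Data.List.Properties using (map-cong-local)
open import Data.List.Relation.Unary.All as All using (All)
import Data.List.Relation.Unary.All.Properties as Allₚ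
open import Data.List.Relation.Unary.Any using (here; there)
open import Data.List.Membership.Propositional using (_∈_)
open import Data.List.Membership.Propositional.Properties using (∈-map⁺; ∈-map⁻; ∈-upTo⁺)
open import Data.Sum using (inj₁; inj₂)
open import Relation.Nullary using (yes; no; Dec)
open import Relation.Nullary.Decidable using (True; toWitness; _×-dec_; _⊎-dec_; _→-dec_; ¬?)
open import Relation.Unary using (Decidable)
open import Data.Product using (_,_; proj₁; proj₂)
open import Relation.Binary.PropositionalEquality using (refl; sym; trans; cong; cong₂; subst; subst₂; module ≡-Reasoning)

toℚᵘ-frac : ∀ a b → toℚᵘ (frac a (suc b)) ℚᵘ.≃ ℚᵘ.mkℚᵘ (+ a) b
toℚᵘ-frac a b = ℚₚ.toℚᵘ-fromℚᵘ (ℚᵘ.mkℚᵘ (+ a) b)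

frac-≡ : ∀ a b c d → a * suc d ≡ c * suc b → frac a (suc b) ≡ frac c (suc d)
frac-≡ a b c d eq = ℚₚ.toℚᵘ-injective (begin
  toℚᵘ (frac a (suc b))  ≈⟨ toℚᵘ-frac a b ⟩
  ℚᵘ.mkℚᵘ (+ a) b        ≈⟨ ℚᵘ.*≡* (trans (sym (ℤₚ.pos-* a (suc d))) (trans (cong +_ eq) (ℤₚ.pos-* c (suc b)))) ⟩
  ℚᵘ.mkℚᵘ (+ c) d        ≈⟨ ℚᵘₚ.≃-sym (toℚᵘ-frac c d) ⟩
  toℚᵘ (frac c (suc d))  ∎)
  where open ℚᵘₚ.≃-Reasoning

frac-≤ : ∀ a b c d → a * suc d ≤ c * suc b → frac a (suc b) ℚ.≤ frac c (suc d)
frac-≤ a b c d le = ℚₚ.toℚᵘ-cancel-≤ (begin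
  toℚᵘ (frac a (suc b))  ≃⟨ toℚᵘ-frac a b ⟩
  ℚᵘ.mkℚᵘ (+ a) b        ≤⟨ ℚᵘ.*≤* (subst₂ ℤ._≤_ (ℤₚ.pos-* a (suc d)) (ℤₚ.pos-* c (suc b)) (ℤ.+≤+ le)) ⟩
  ℚᵘ.mkℚᵘ (+ c) d        ≃⟨ ℚᵘₚ.≃-sym (toℚᵘ-frac c d) ⟩
  toℚᵘ (frac c (suc d))  ∎)
  where open ℚᵘₚ.≤-Reasoning

frac-* : ∀ a b c d → frac a (suc b) ℚ.* frac c (suc d) ≡ frac (a * c) (suc b * suc d)
frac-* a b c d = ℚₚ.toℚᵘ-injective (begin
  toℚᵘ (frac a (suc b) ℚ.* frac c (suc d))            ≈⟨ ℚₚ.toℚᵘ-homo-* (frac a (suc b)) (frac c (suc d)) ⟩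
  toℚᵘ (frac a (suc b)) ℚᵘ.* toℚᵘ (frac c (suc d))   ≈⟨ ℚᵘₚ.*-cong (toℚᵘ-frac a b) (toℚᵘ-frac c d) ⟩
  ℚᵘ.mkℚᵘ (+ a) b ℚᵘ.* ℚᵘ.mkℚᵘ (+ c) d
    ≈⟨ ℚᵘ.*≡* (cong (ℤ._* + (suc b * suc d)) (sym (ℤₚ.pos-* a c))) ⟩
  ℚᵘ.mkℚᵘ (+ (a * c)) (d + b * suc d)                  ≈⟨ ℚᵘₚ.≃-sym (toℚᵘ-frac (a * c) (d + b * suc d)) ⟩
  toℚᵘ (frac (a * c) (suc b * suc d))                  ∎)
  where open ℚᵘₚ.≃-Reasoning

frac-+ : ∀ a b c d → frac a (suc b) ℚ.+ frac c (suc d) ≡ frac (a * suc d + c * suc b) (suc b * suc d)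
frac-+ a b c d = ℚₚ.toℚᵘ-injective (begin
  toℚᵘ (frac a (suc b) ℚ.+ frac c (suc d))            ≈⟨ ℚₚ.toℚᵘ-homo-+ (frac a (suc b)) (frac c (suc d)) ⟩
  toℚᵘ (frac a (suc b)) ℚᵘ.+ toℚᵘ (frac c (suc d))   ≈⟨ ℚᵘₚ.+-cong (toℚᵘ-frac a b) (toℚᵘ-frac c d) ⟩
  ℚᵘ.mkℚᵘ (+ a) b ℚᵘ.+ ℚᵘ.mkℚᵘ (+ c) d                ≈⟨ ℚᵘ.*≡* (cong (ℤ._* + (suc b * suc d)) numerator) ⟩
  ℚᵘ.mkℚᵘ (+ (a * suc d + c * suc b)) (d + b * suc d) ≈⟨ ℚᵘₚ.≃-sym (toℚᵘ-frac _ (d + b * suc d)) ⟩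
  toℚᵘ (frac (a * suc d + c * suc b) (suc b * suc d)) ∎)
  where
  open ℚᵘₚ.≃-Reasoning
  numerator : + a ℤ.* + suc d ℤ.+ + c ℤ.* + suc b ≡ + (a * suc d + c * suc b)
  numerator = sym (trans (ℤₚ.pos-+ (a * suc d) (c * suc b)) (cong₂ ℤ._+_ (ℤₚ.pos-* a (suc d)) (ℤₚ.pos-* c (suc b))))

0≤frac : ∀ a b → 0ℚ ℚ.≤ frac a (suc b)
0≤frac a b = frac-≤ 0 0 a b z≤n

frac≤1 : ∀ a b → a ≤ suc b → frac a (suc b) ℚ.≤ 1ℚ
frac≤1 a b a≤1+b = frac-≤ a b 1 0 (subst (a * 1 ≤_) (ℕₚ.*-comm (suc b) 1) (ℕₚ.*-monoˡ-≤ 1 a≤1+b))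

frac-mono-≤ : ∀ {a c} d → a ≤ c → frac a (suc d) ℚ.≤ frac c (suc d)
frac-mono-≤ {a} {c} d a≤c = frac-≤ a d c d (ℕₚ.*-monoˡ-≤ (suc d) a≤c)

frac-scale : ∀ c a n → frac a (suc n) ≡ frac (suc c * a) (suc c * suc n)
frac-scale c a n = frac-≡ a n (suc c * a) (n + c * suc n) (ℕ-solve (c ∷ a ∷ n ∷ []))

frac-+-same : ∀ a c d → frac a (suc d) ℚ.+ frac c (suc d) ≡ frac (a + c) (suc d)
frac-+-same a c d = trans (frac-+ a d c d) (frac-≡ (a * suc d + c * suc d) (d + d * suc d) (a + c) d (ℕ-solve (a ∷ c ∷ d ∷ [])))

frac-sum≡1 : ∀ {a c d} → a + c ≡ suc d → frac a (suc d) ℚ.+ frac c (suc d) ≡ 1ℚ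
frac-sum≡1 {a} {c} {d} a+c≡1+d = trans (frac-+-same a c d) (frac-≡ (a + c) d 1 0 (begin
  (a + c) * 1   ≡⟨ cong (_* 1) a+c≡1+d ⟩
  suc d * 1     ≡⟨ ℕₚ.*-comm (suc d) 1 ⟩
  1 * suc d     ∎))
  where open ≡-Reasoning

1-frac : ∀ {a c d} → a + c ≡ suc d → 1ℚ ℚ.- frac a (suc d) ≡ frac c (suc d)
1-frac {a} {c} {d} a+c≡1+d = begin
  1ℚ ℚ.- frac a (suc d)
    ≡⟨ cong (ℚ._- frac a (suc d)) (frac-sum≡1 {c} {a} (trans (ℕₚ.+-comm c a) a+c≡1+d)) ⟨
  (frac c (suc d) ℚ.+ frac a (suc d)) ℚ.- frac a (suc d) ≡⟨ solve 2 (λ x y → (x :+ y) :- y := x) refl (frac c (suc d)) (frac a (suc d)) ⟩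
  frac c (suc d)                                         ∎
  where open ≡-Reasoning; open +-*-Solver

frac≤1-frac : ∀ a n c d → a * suc d + c * suc n ≤ suc n * suc d → frac a (suc n) ℚ.≤ 1ℚ ℚ.- frac c (suc d)
frac≤1-frac a n c d le = begin
  frac a (suc n)                                          ≡⟨ solve 2 (λ x y → x := (x :+ y) :- y) refl (frac a (suc n)) (frac c (suc d)) ⟩
  (frac a (suc n) ℚ.+ frac c (suc d)) ℚ.- frac c (suc d)  ≤⟨ ℚₚ.+-monoˡ-≤ (ℚ.- frac c (suc d)) sum≤1 ⟩
  1ℚ ℚ.- frac c (suc d)                                   ∎
  where
  open ℚₚ.≤-Reasoning; open +-*-Solver
  sum≤1 : frac a (suc n) ℚ.+ frac c (suc d) ℚ.≤ 1ℚ
  sum≤1 = subst (ℚ._≤ 1ℚ) (sym (frac-+ a n c d)) (frac≤1 (a * suc d + c * suc n) (d + n * suc d) le)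

frac-cancel : ∀ k n A → frac (suc k) (suc n) ℚ.* frac A (12 * suc k) ≡ frac A (12 * suc n)
frac-cancel k n A = trans (frac-* (suc k) n A _) (frac-≡ (suc k * A) _ A _ (ℕ-solve (k ∷ n ∷ A ∷ [])))

p≤q⇒0≤q-p : ∀ {p q} → p ℚ.≤ q → 0ℚ ℚ.≤ q ℚ.- p
p≤q⇒0≤q-p {p} {q} h = subst (ℚ._≤ q ℚ.- p) (ℚₚ.+-inverseʳ p) (ℚₚ.+-monoˡ-≤ (ℚ.- p) h)

p-r≤p-q : ∀ p {q r} → q ℚ.≤ r → p ℚ.- r ℚ.≤ p ℚ.- q
p-r≤p-q p q≤r = ℚₚ.+-monoʳ-≤ p (ℚₚ.neg-antimono-≤ q≤r)

p-q≤p : ∀ p {q} → 0ℚ ℚ.≤ q → p ℚ.- q ℚ.≤ p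
p-q≤p p {q} 0≤q = subst (p ℚ.- q ℚ.≤_) (ℚₚ.+-identityʳ p) (p-r≤p-q p 0≤q)

p≤p+q : ∀ p {q} → 0ℚ ℚ.≤ q → p ℚ.≤ p ℚ.+ q
p≤p+q p {q} 0≤q = subst (ℚ._≤ p ℚ.+ q) (ℚₚ.+-identityʳ p) (ℚₚ.+-monoʳ-≤ p 0≤q)

*-monoˡ-≤-frac : ∀ a b {p q} → p ℚ.≤ q → frac a (suc b) ℚ.* p ℚ.≤ frac a (suc b) ℚ.* q
*-monoˡ-≤-frac a b = ℚₚ.*-monoˡ-≤-nonNeg (frac a (suc b)) {{ℚ.nonNegative (0≤frac a b)}}

0≤frac* : ∀ a b {p} → 0ℚ ℚ.≤ p → 0ℚ ℚ.≤ frac a (suc b) ℚ.* p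
0≤frac* a b {p} 0≤p = subst (ℚ._≤ frac a (suc b) ℚ.* p) (ℚₚ.*-zeroʳ (frac a (suc b))) (*-monoˡ-≤-frac a b 0≤p)

-- Weighted means

mean : ℕ → ℕ → ℚ → ℚ → ℚ
mean a b x y = frac a (a + b) ℚ.* x ℚ.+ frac b (a + b) ℚ.* y

mean≡y-w[y-x] : ∀ a b x y → mean (suc a) b x y ≡ y ℚ.- frac (suc a) (suc a + b) ℚ.* (y ℚ.- x)
mean≡y-w[y-x] a b x y = begin
  w ℚ.* x ℚ.+ v ℚ.* y
    ≡⟨ solve 4 (λ w v x y → w :* x :+ v :* y := y :- w :* (y :- x) :+ (w :+ v :- con 1ℚ) :* y) refl w v x y ⟩
  y ℚ.- w ℚ.* (y ℚ.- x) ℚ.+ (w ℚ.+ v ℚ.- 1ℚ) ℚ.* y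
    ≡⟨ cong (λ s → y ℚ.- w ℚ.* (y ℚ.- x) ℚ.+ (s ℚ.- 1ℚ) ℚ.* y) (frac-sum≡1 {suc a} {b} refl) ⟩
  y ℚ.- w ℚ.* (y ℚ.- x) ℚ.+ (1ℚ ℚ.- 1ℚ) ℚ.* y
    ≡⟨ solve 3 (λ w x y → y :- w :* (y :- x) :+ (con 1ℚ :- con 1ℚ) :* y := y :- w :* (y :- x)) refl w x y ⟩
  y ℚ.- w ℚ.* (y ℚ.- x)
    ∎
  where
  open ≡-Reasoning; open +-*-Solver
  w = frac (suc a) (suc a + b)
  v = frac b (suc a + b)

mean-const : ∀ a b x → mean (suc a) b x x ≡ x
mean-const a b x = trans (mean≡y-w[y-x] a b x x) (solve 2 (λ w x → x :- w :* (x :- x) := x) refl (frac (suc a) (suc a + b)) x)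
  where open +-*-Solver

mean-1- : ∀ a b x y → mean (suc a) b (1ℚ ℚ.- x) (1ℚ ℚ.- y) ≡ 1ℚ ℚ.- mean (suc a) b x y
mean-1- a b x y = begin
  mean (suc a) b (1ℚ ℚ.- x) (1ℚ ℚ.- y)                 ≡⟨ mean≡y-w[y-x] a b _ _ ⟩
  (1ℚ ℚ.- y) ℚ.- w ℚ.* ((1ℚ ℚ.- y) ℚ.- (1ℚ ℚ.- x))
    ≡⟨ solve 3 (λ w x y → (con 1ℚ :- y) :- w :* ((con 1ℚ :- y) :- (con 1ℚ :- x)) := con 1ℚ :- (y :- w :* (y :- x))) refl w x y ⟩
  1ℚ ℚ.- (y ℚ.- w ℚ.* (y ℚ.- x))                       ≡⟨ cong (λ z → 1ℚ ℚ.- z) (mean≡y-w[y-x] a b x y) ⟨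
  1ℚ ℚ.- mean (suc a) b x y                             ∎
  where
  open ≡-Reasoning; open +-*-Solver
  w = frac (suc a) (suc a + b)

mean-mono : ∀ a b {x x′ y y′} → x ℚ.≤ x′ → y ℚ.≤ y′ → mean (suc a) b x y ℚ.≤ mean (suc a) b x′ y′
mean-mono a b x≤x′ y≤y′ = ℚₚ.+-mono-≤ (*-monoˡ-≤-frac (suc a) (a + b) x≤x′) (*-monoˡ-≤-frac b (a + b) y≤y′)

mean≤max : ∀ a b {x y} → x ℚ.≤ y → mean (suc a) b x y ℚ.≤ y
mean≤max a b {x} {y} x≤y = subst (ℚ._≤ y) (sym (mean≡y-w[y-x] a b x y)) (p-q≤p y (0≤frac* (suc a) (a + b) (p≤q⇒0≤q-p x≤y)))

mean-shift : ∀ a b {x y y′} → x ℚ.≤ y → y ℚ.≤ y′ → mean (suc a) b x y ℚ.≤ mean (suc a) (suc b) x y′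
mean-shift a b {x} {y} {y′} x≤y y≤y′ = begin
  mean (suc a) b x y                           ≡⟨ mean≡y-w[y-x] a b x y ⟩
  y ℚ.- frac (suc a) (suc a + b) ℚ.* (y ℚ.- x)
    ≤⟨ p-r≤p-q y (ℚₚ.*-monoʳ-≤-nonNeg (y ℚ.- x) {{ℚ.nonNegative (p≤q⇒0≤q-p x≤y)}} weight≤) ⟩
  y ℚ.- frac (suc a) (suc a + suc b) ℚ.* (y ℚ.- x) ≡⟨ mean≡y-w[y-x] a (suc b) x y ⟨
  mean (suc a) (suc b) x y                     ≤⟨ mean-mono a (suc b) ℚₚ.≤-refl y≤y′ ⟩
  mean (suc a) (suc b) x y′                    ∎
  where
  open ℚₚ.≤-Reasoning
  weight≤ : frac (suc a) (suc a + suc b) ℚ.≤ frac (suc a) (suc a + b)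
  weight≤ = frac-≤ (suc a) (a + suc b) (suc a) (a + b) (ℕₚ.*-monoʳ-≤ (suc a) (s≤s (ℕₚ.+-monoʳ-≤ a (ℕₚ.n≤1+n b))))

mean-frac : ∀ a b A B → mean (suc a) (suc b) (frac A (12 * suc a)) (frac B (12 * suc b)) ≡ frac (A + B) (12 * (suc a + suc b))
mean-frac a b A B = trans (cong₂ ℚ._+_ (frac-cancel a (a + suc b) A) (frac-cancel b (a + suc b) B)) (frac-+-same A B _)

mean-frac-common : ∀ a b A B d → mean (suc a) b (frac A (suc d)) (frac B (suc d)) ≡ frac (suc a * A + b * B) ((suc a + b) * suc d)
mean-frac-common a b A B d = trans (cong₂ ℚ._+_ (frac-* (suc a) (a + b) A d) (frac-* b (a + b) B d)) (frac-+-same (suc a * A) (b * B) _)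

-- Compares splitting off 2 with splitting off 1 when P m 1 = u and P m 2 = u + u.
mean-trade : ∀ b {u x y} → x ℚ.≤ y → u ℚ.+ u ℚ.+ u ℚ.≤ y → mean 2 b (u ℚ.+ u) x ℚ.≤ mean 1 (suc b) u y
mean-trade b {u} {x} {y} x≤y 3u≤y = begin
  frac 2 N ℚ.* (u ℚ.+ u) ℚ.+ F ℚ.* x                 ≡⟨ cong (λ v → v ℚ.* (u ℚ.+ u) ℚ.+ F ℚ.* x) (frac-+-same 1 1 (suc b)) ⟨
  (w ℚ.+ w) ℚ.* (u ℚ.+ u) ℚ.+ F ℚ.* x
    ≤⟨ p≤p+q _ (ℚₚ.+-mono-≤ (0≤frac* 1 (suc b) (p≤q⇒0≤q-p 3u≤y)) (0≤frac* b (suc b) (p≤q⇒0≤q-p x≤y))) ⟩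
  (w ℚ.+ w) ℚ.* (u ℚ.+ u) ℚ.+ F ℚ.* x ℚ.+ (w ℚ.* (y ℚ.- (u ℚ.+ u ℚ.+ u)) ℚ.+ F ℚ.* (y ℚ.- x))
    ≡⟨ solve 5 (λ w F u x y → (w :+ w) :* (u :+ u) :+ F :* x :+ (w :* (y :- (u :+ u :+ u)) :+ F :* (y :- x))
                               := w :* u :+ (w :+ F) :* y) refl w F u x y ⟩
  w ℚ.* u ℚ.+ (w ℚ.+ F) ℚ.* y                        ≡⟨ cong (λ v → w ℚ.* u ℚ.+ v ℚ.* y) (frac-+-same 1 b (suc b)) ⟩
  w ℚ.* u ℚ.+ frac (suc b) N ℚ.* y                   ∎
  where
  open ℚₚ.≤-Reasoning; open +-*-Solver
  N = 2 + b
  w = frac 1 N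
  F = frac b N

-- P as a maximum over the decisions

foldr-⊔-lub : ∀ {b x} ys → b ℚ.≤ x → All (ℚ._≤ x) ys → foldr _⊔_ b ys ℚ.≤ x
foldr-⊔-lub []       b≤x All.[]             = b≤x
foldr-⊔-lub (y ∷ ys) b≤x (y≤x All.∷ ys≤x) = ℚₚ.⊔-lub y≤x (foldr-⊔-lub ys b≤x ys≤x)

foldr-⊔-≥base : ∀ b ys → b ℚ.≤ foldr _⊔_ b ys
foldr-⊔-≥base b []       = ℚₚ.≤-refl
foldr-⊔-≥base b (y ∷ ys) = ℚₚ.≤-trans (foldr-⊔-≥base b ys) (ℚₚ.p≤q⊔p y _)

foldr-⊔-≥elem : ∀ b {y ys} → y ∈ ys → y ℚ.≤ foldr _⊔_ b ys
foldr-⊔-≥elem b {ys = y ∷ ys}  (here refl) = ℚₚ.p≤p⊔q y _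
foldr-⊔-≥elem b {ys = y′ ∷ ys} (there y∈ys) = ℚₚ.≤-trans (foldr-⊔-≥elem b y∈ys) (ℚₚ.p≤q⊔p y′ _)

foldr-⊔-sel : ∀ b ys → foldr _⊔_ b ys ≡ b ⊎ foldr _⊔_ b ys ∈ ys
foldr-⊔-sel b []       = inj₁ refl
foldr-⊔-sel b (y ∷ ys) with ℚₚ.⊔-sel y (foldr _⊔_ b ys) | foldr-⊔-sel b ys
... | inj₁ ≡y | _          = inj₂ (here ≡y)
... | inj₂ ≡m | inj₁ m≡b   = inj₁ (trans ≡m m≡b)
... | inj₂ ≡m | inj₂ m∈ys  = inj₂ (there (subst (_∈ ys) (sym ≡m) m∈ys))

Split : ℕ → ℕ → Set
Split n k = 1 ≤ k × k + k ≤ n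

k+k≡k*2 : ∀ k → k + k ≡ k * 2
k+k≡k*2 k = ℕ-solve (k ∷ [])

k≤n/2⇒k+k≤n : ∀ {n k} → k ≤ n ℕ./ 2 → k + k ≤ n
k≤n/2⇒k+k≤n {n} {k} k≤n/2 = subst (_≤ n) (sym (k+k≡k*2 k)) (ℕₚ.≤-trans (ℕₚ.*-monoˡ-≤ 2 k≤n/2) (m/n*n≤m n 2))

k+k≤n⇒k≤n/2 : ∀ {n k} → k + k ≤ n → k ≤ n ℕ./ 2
k+k≤n⇒k≤n/2 {n} {k} k+k≤n = subst (_≤ n ℕ./ 2) (m*n/n≡m k 2) (/-monoˡ-≤ 2 (subst (_≤ n) (k+k≡k*2 k) k+k≤n))

split⇒≤∸ : ∀ {n k} → Split n k → k ≤ n ∸ k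
split⇒≤∸ {k = k} (_ , k+k≤n) = ℕₚ.m+n≤o⇒m≤o∸n k k+k≤n

split⇒< : ∀ {n k} → Split n k → k < n
split⇒< {k = k} (1≤k , k+k≤n) = ℕₚ.<-≤-trans (ℕₚ.m<m+n k 1≤k) k+k≤n

split⇒∸< : ∀ {n k} → Split n k → n ∸ k < n
split⇒∸< {n} {k} s@(1≤k , _) = ℕₚ.∸-monoʳ-< 1≤k (ℕₚ.<⇒≤ (split⇒< s))

decisions-split : ∀ n → All (Split n) (decisions n)
decisions-split n = Allₚ.map⁺ (All.map (λ k<n/2 → s≤s z≤n , k≤n/2⇒k+k≤n k<n/2) (Allₚ.all-upTo (n ℕ./ 2)))

split∈decisions : ∀ {n k} → Split n k → k ∈ decisions n
split∈decisions {k = suc k} (_ , k+k≤n) = ∈-map⁺ suc (∈-upTo⁺ (k+k≤n⇒k≤n/2 k+k≤n))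

val′ : (ℕ → ℚ) → ℕ → ℕ → ℚ
val′ X n k = (1ℚ ℚ.- frac k n ℚ.* X k) ℚ.- frac (n ∸ k) n ℚ.* X (n ∸ k)

-- Pf (suc f) (suc n) m is definitionally best (Pf f m) (suc n).
best : (ℕ → ℚ) → ℕ → ℚ
best X n = foldr _⊔_ (frac 1 n) (map (val′ X n) (decisions n))

best-cong : ∀ {X Y} n → (∀ {j} → 1 ≤ j → j < n → X j ≡ Y j) → best X n ≡ best Y n
best-cong {X} {Y} n X≗Y = cong (foldr _⊔_ (frac 1 n)) (map-cong-local (All.map same-value (decisions-split n)))
  where
  same-value : ∀ {k} → Split n k → val′ X n k ≡ val′ Y n k
  same-value {k} s@(1≤k , _) = cong₂ (λ x y → (1ℚ ℚ.- frac k n ℚ.* x) ℚ.- frac (n ∸ k) n ℚ.* y)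
    (X≗Y 1≤k (split⇒< s)) (X≗Y (ℕₚ.≤-trans 1≤k (split⇒≤∸ s)) (split⇒∸< s))

Pf-stable : ∀ {f g} n m → n + m ≤ f → n + m ≤ g → Pf f n m ≡ Pf g n m
Pf-stable {zero}  {zero}  zero    m _ _ = refl
Pf-stable {zero}  {suc g} zero    m _ _ = refl
Pf-stable {suc f} {zero}  zero    m _ _ = refl
Pf-stable {suc f} {suc g} zero    m _ _ = refl
Pf-stable {suc f} {suc g} (suc n) m (s≤s n+m≤f) (s≤s n+m≤g) =
  best-cong {Pf f m} {Pf g m} (suc n) (λ {j} _ j≤n → Pf-stable m j (move-bound j≤n n+m≤f) (move-bound j≤n n+m≤g))
  where
  move-bound : ∀ {j h} → j < suc n → n + m ≤ h → m + j ≤ h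
  move-bound {j} (s≤s j≤n) n+m≤h =
    ℕₚ.≤-trans (ℕₚ.≤-trans (ℕₚ.+-monoʳ-≤ m j≤n) (ℕₚ.≤-reflexive (ℕₚ.+-comm m n))) n+m≤h

P-bellman : ∀ n m → P (suc n) m ≡ best (P m) (suc n)
P-bellman n m = best-cong {Pf (n + m) m} {P m} (suc n) (λ {j} _ j<1+n →
  Pf-stable m j (ℕₚ.≤-trans (ℕₚ.+-monoʳ-≤ m (ℕₚ.≤-pred j<1+n)) (ℕₚ.≤-reflexive (ℕₚ.+-comm m n))) ℕₚ.≤-refl)

guess≤P : ∀ n m → frac 1 (suc n) ℚ.≤ P (suc n) m
guess≤P n m = subst (frac 1 (suc n) ℚ.≤_) (sym (P-bellman n m))
  (foldr-⊔-≥base (frac 1 (suc n)) (map (val (suc n) m) (decisions (suc n))))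

val≤P : ∀ {n m k} → Split (suc n) k → val (suc n) m k ℚ.≤ P (suc n) m
val≤P {n} {m} {k} s = subst (val (suc n) m k ℚ.≤_) (sym (P-bellman n m))
  (foldr-⊔-≥elem (frac 1 (suc n)) (∈-map⁺ (val (suc n) m) (split∈decisions s)))

P-lub : ∀ {n m x} → frac 1 (suc n) ℚ.≤ x → (∀ {k} → Split (suc n) k → val (suc n) m k ℚ.≤ x) → P (suc n) m ℚ.≤ x
P-lub {n} {m} {x} guess≤x vals≤x = subst (ℚ._≤ x) (sym (P-bellman n m))
  (foldr-⊔-lub (map (val (suc n) m) (decisions (suc n))) guess≤x (Allₚ.map⁺ (All.map vals≤x (decisions-split (suc n)))))

P-attained : ∀ n m → P (suc n) m ≡ frac 1 (suc n) ⊎ ∃[ k ] (Split (suc n) k × P (suc n) m ≡ val (suc n) m k)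
P-attained n m = attained (foldr-⊔-sel (frac 1 (suc n)) vals)
  where
  vals = map (val (suc n) m) (decisions (suc n))
  attained : foldr _⊔_ (frac 1 (suc n)) vals ≡ frac 1 (suc n) ⊎ foldr _⊔_ (frac 1 (suc n)) vals ∈ vals →
             P (suc n) m ≡ frac 1 (suc n) ⊎ ∃[ k ] (Split (suc n) k × P (suc n) m ≡ val (suc n) m k)
  attained (inj₁ ≡guess) = inj₁ (trans (P-bellman n m) ≡guess)
  attained (inj₂ ∈vals)  = let k , k∈ , ≡val = ∈-map⁻ (val (suc n) m) ∈vals in
                           inj₂ (k , All.lookup (decisions-split (suc n)) k∈ , trans (P-bellman n m) ≡val)

P≡val : ∀ {n m d} → Split (suc n) d → frac 1 (suc n) ℚ.≤ val (suc n) m d →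
        (∀ {k} → Split (suc n) k → val (suc n) m k ℚ.≤ val (suc n) m d) → P (suc n) m ≡ val (suc n) m d
P≡val s guess≤ vals≤ = ℚₚ.≤-antisym (P-lub guess≤ vals≤) (val≤P s)

split-optimal : ∀ {n m d} → Split n d → P n m ≡ val n m d → Optimal n m d
split-optimal (1≤d , d+d≤n) P≡ = inj₂ (1≤d , k+k≤n⇒k≤n/2 d+d≤n , P≡)

0≤P : ∀ n m → 0ℚ ℚ.≤ P n m
0≤P zero    zero    = ℚₚ.≤-refl
0≤P zero    (suc m) = ℚₚ.≤-refl
0≤P (suc n) m       = ℚₚ.≤-trans (0≤frac 1 n) (guess≤P n m)

val≤1 : ∀ n m k → val (suc n) m k ℚ.≤ 1ℚ
val≤1 n m k = ℚₚ.≤-trans (p-q≤p _ (0≤frac* (suc n ∸ k) n (0≤P m (suc n ∸ k)))) (p-q≤p 1ℚ (0≤frac* k n (0≤P m k)))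

P≤1 : ∀ n m → P (suc n) m ℚ.≤ 1ℚ
P≤1 n m = P-lub {n} {m} (frac≤1 1 n (s≤s z≤n)) (λ {k} _ → val≤1 n m k)

val-split : ∀ {n} m k j → k + j ≡ n → val n m k ≡ 1ℚ ℚ.- mean k j (P m k) (P m j)
val-split m k j refl rewrite ℕₚ.m+n∸m≡n k j =
  solve 3 (λ 1′ a b → (1′ :- a) :- b := 1′ :- (a :+ b)) refl 1ℚ (frac k (k + j) ℚ.* P m k) (frac j (k + j) ℚ.* P m j)
  where open +-*-Solver

val-antitoneʳ : ∀ {n m m′ k} → P m′ k ℚ.≤ P m k → P m′ (suc n ∸ k) ℚ.≤ P m (suc n ∸ k) →
                val (suc n) m k ℚ.≤ val (suc n) m′ k
val-antitoneʳ {n} {k = k} ≤k ≤n-k =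
  ℚₚ.+-mono-≤ (ℚₚ.+-monoʳ-≤ 1ℚ (ℚₚ.neg-antimono-≤ (*-monoˡ-≤-frac k n ≤k)))
              (ℚₚ.neg-antimono-≤ (*-monoˡ-≤-frac (suc n ∸ k) n ≤n-k))

-- Monotonicity

val-shift≤ : ∀ {n M k} → Split (suc n) k → P M k ℚ.≤ P M (suc n ∸ k) → P M (suc n ∸ k) ℚ.≤ P M (suc (suc n ∸ k)) →
             val (suc (suc n)) M k ℚ.≤ val (suc n) M k
val-shift≤ {n} {M} {suc k} s x≤y y≤y′ = begin
  val (suc (suc n)) M (suc k)                             ≡⟨ val-split M (suc k) (suc j) (trans (ℕₚ.+-suc (suc k) j) (cong suc k+j≡1+n)) ⟩
  1ℚ ℚ.- mean (suc k) (suc j) (P M (suc k)) (P M (suc j))   ≤⟨ p-r≤p-q 1ℚ (mean-shift k j x≤y y≤y′) ⟩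
  1ℚ ℚ.- mean (suc k) j (P M (suc k)) (P M j)               ≡⟨ val-split M (suc k) j k+j≡1+n ⟨
  val (suc n) M (suc k)                                   ∎
  where
  open ℚₚ.≤-Reasoning
  j = suc n ∸ suc k
  k+j≡1+n : suc k + j ≡ suc n
  k+j≡1+n = ℕₚ.m+[n∸m]≡n (ℕₚ.<⇒≤ (split⇒< s))

val-middle≤P : ∀ {n M} k → suc k + suc k ≡ suc (suc n) → (1 ≤ k → P M k ℚ.≤ P M (suc k)) →
               val (suc (suc n)) M (suc k) ℚ.≤ P (suc n) M
val-middle≤P {M = M} zero    refl _    = val≤1 1 M 1  -- P 1 M evaluates to 1ℚ
val-middle≤P {M = M} (suc k) refl mono = begin
  val (suc (suc k) + suc (suc k)) M (suc (suc k))           ≡⟨ val-split M (suc (suc k)) (suc (suc k)) refl ⟩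
  1ℚ ℚ.- mean (suc (suc k)) (suc (suc k)) y y               ≡⟨ cong (λ z → 1ℚ ℚ.- z) (mean-const (suc k) (suc (suc k)) y) ⟩
  1ℚ ℚ.- y                                                  ≤⟨ p-r≤p-q 1ℚ (mean≤max k (suc (suc k)) (mono (s≤s z≤n))) ⟩
  1ℚ ℚ.- mean (suc k) (suc (suc k)) (P M (suc k)) y         ≡⟨ val-split M (suc k) (suc (suc k)) refl ⟨
  val (suc k + suc (suc k)) M (suc k)                       ≤⟨ val≤P (s≤s z≤n , s≤s (ℕₚ.+-monoʳ-≤ k (ℕₚ.n≤1+n _))) ⟩
  P (suc k + suc (suc k)) M                                 ∎
  where
  open ℚₚ.≤-Reasoning
  y = P M (suc (suc k))

steps⇒mono-≤ : ∀ (f : ℕ → ℚ) {a b} → (∀ {j} → a ≤ j → j < b → f j ℚ.≤ f (suc j)) → a ≤ b → f a ℚ.≤ f b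
steps⇒mono-≤ f {b = zero}  step z≤n = ℚₚ.≤-refl
steps⇒mono-≤ f {b = suc b} step a≤1+b with ℕₚ.m≤n⇒m<n∨m≡n a≤1+b
... | inj₂ refl       = ℚₚ.≤-refl
... | inj₁ (s≤s a≤b) =
  ℚₚ.≤-trans (steps⇒mono-≤ f (λ a≤j j<b → step a≤j (ℕₚ.m≤n⇒m≤1+n j<b)) a≤b) (step a≤b ℕₚ.≤-refl)

P-own-step : ∀ {n M} → (∀ {a b} → 1 ≤ a → a ≤ b → b ≤ suc n → P M a ℚ.≤ P M b) → P (suc (suc n)) M ℚ.≤ P (suc n) M
P-own-step {n} {M} mono = P-lub {suc n} {M} guess≤ vals≤
  where
  guess≤ : frac 1 (suc (suc n)) ℚ.≤ P (suc n) M
  guess≤ = ℚₚ.≤-trans (frac-≤ 1 (suc n) 1 n (ℕₚ.*-monoʳ-≤ 1 (ℕₚ.n≤1+n _))) (guess≤P n M)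
  vals≤ : ∀ {k} → Split (suc (suc n)) k → val (suc (suc n)) M k ℚ.≤ P (suc n) M
  vals≤ {suc k} (1≤k , k+k≤2+n) with suc k + suc k ≤? suc n
  ... | yes k+k≤1+n = ℚₚ.≤-trans (val-shift≤ {n} {M} s (mono 1≤k (split⇒≤∸ s) (ℕₚ.m∸n≤m (suc n) (suc k)))
                                               (mono (ℕₚ.≤-trans 1≤k (split⇒≤∸ s)) (ℕₚ.n≤1+n _) (split⇒∸< s)))
                                  (val≤P {n} {M} s)
    where s = (1≤k , k+k≤1+n)
  ... | no k+k≰1+n = val-middle≤P {n} {M} k (ℕₚ.≤-antisym k+k≤2+n (ℕₚ.≰⇒> k+k≰1+n))
                       (λ 1≤k → mono 1≤k (ℕₚ.n≤1+n k) (ℕₚ.≤-trans (ℕₚ.m≤n+m (suc k) k) (ℕₚ.≤-pred k+k≤2+n)))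

P-opponent-step : ∀ {n M} → (∀ {j} → 1 ≤ j → j ≤ n → P (suc M) j ℚ.≤ P M j) → P (suc n) M ℚ.≤ P (suc n) (suc M)
P-opponent-step {n} {M} antitone = P-lub {n} {M} (guess≤P n (suc M)) vals≤
  where
  vals≤ : ∀ {k} → Split (suc n) k → val (suc n) M k ℚ.≤ P (suc n) (suc M)
  vals≤ {k} s@(1≤k , _) = ℚₚ.≤-trans (val-antitoneʳ {n} {M} {suc M} {k} (antitone 1≤k (ℕₚ.≤-pred (split⇒< s)))
                                                (antitone (ℕₚ.≤-trans 1≤k (split⇒≤∸ s)) (ℕₚ.≤-pred (split⇒∸< s))))
                                 (val≤P {n} {suc M} s)

-- Both steps at (n , M) only use the steps at (M , j) for j ≤ n, whose boards are smaller.
P-steps : ∀ s {n m} → n + m ≤ s → 1 ≤ n → 1 ≤ m → P (suc n) m ℚ.≤ P n m × P n m ℚ.≤ P n (suc m)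
P-steps s       {zero}  _  () _
P-steps zero    {suc n} () _  _
P-steps (suc s) {suc n} {M} (s≤s n+M≤s) _ 1≤M =
  P-own-step (λ 1≤a a≤b b≤1+n → steps⇒mono-≤ (P M)
    (λ a≤j j<b → proj₂ (IH (ℕₚ.≤-pred (ℕₚ.<-≤-trans j<b b≤1+n)) (ℕₚ.≤-trans 1≤a a≤j))) a≤b) ,
  P-opponent-step (λ 1≤j j≤n → proj₁ (IH j≤n 1≤j))
  where
  IH : ∀ {j} → j ≤ n → 1 ≤ j → P (suc M) j ℚ.≤ P M j × P M j ℚ.≤ P M (suc j)
  IH j≤n = P-steps s (ℕₚ.≤-trans (ℕₚ.+-monoʳ-≤ M j≤n) (ℕₚ.≤-trans (ℕₚ.≤-reflexive (ℕₚ.+-comm M n)) n+M≤s)) 1≤M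

P-monoʳ-≤ : ∀ {n a b} → 1 ≤ n → 1 ≤ a → a ≤ b → P n a ℚ.≤ P n b
P-monoʳ-≤ {n} 1≤n 1≤a = steps⇒mono-≤ (P n) (λ a≤j _ → proj₂ (P-steps _ ℕₚ.≤-refl 1≤n (ℕₚ.≤-trans 1≤a a≤j)))

-- Closed forms for m ≤ 4

nlt-step : ∀ n → nlt (4 + n) ≡ 2 + nlt n
nlt-step n =
  trans (cong₂ _+_ (m/n≡1+[m∸n]/n (ℕₚ.m≤m+n 4 n)) (m/n≡1+[m∸n]/n (ℕₚ.≤-trans (ℕₚ.m≤m+n 4 n) (ℕₚ.n≤1+n _))))
        (cong suc (ℕₚ.+-suc (n ℕ./ 4) (suc n ℕ./ 4)))

nlt-half : ∀ n → nlt n + nlt n ≤ n × n ≤ 2 + (nlt n + nlt n)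
nlt-half 0 = z≤n , z≤n
nlt-half 1 = z≤n , s≤s z≤n
nlt-half 2 = z≤n , ℕₚ.≤-refl
nlt-half 3 = ℕₚ.n≤1+n 2 , ℕₚ.n≤1+n 3
nlt-half (suc (suc (suc (suc n)))) rewrite nlt-step n =
  let lower , upper = nlt-half n in
  subst (_≤ 4 + n) (sym (2+x+2+x (nlt n))) (ℕₚ.+-monoʳ-≤ 4 lower) ,
  subst (λ y → 4 + n ≤ 2 + y) (sym (2+x+2+x (nlt n))) (ℕₚ.+-monoʳ-≤ 4 upper)
  where
  2+x+2+x : ∀ x → (2 + x) + (2 + x) ≡ 4 + (x + x)
  2+x+2+x x = ℕ-solve (x ∷ [])

nlt-lb : ∀ t {n} → 2 + (t + t) ≤ n → t ≤ nlt n
nlt-lb t {n} 2+t+t≤n = ℕₚ.*-cancelʳ-≤ t (nlt n) 2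
  (subst₂ _≤_ (k+k≡k*2 t) (k+k≡k*2 (nlt n)) (ℕₚ.+-cancelˡ-≤ 2 _ _ (ℕₚ.≤-trans 2+t+t≤n (proj₂ (nlt-half n)))))

computed-below : ∀ {p} {Q : ℕ → Set p} (Q? : Decidable Q) b → {True (allUpTo? Q? b)} → (∀ z → Q (b + z)) → ∀ n → Q n
computed-below {Q = Q} Q? b {below} above n with n <? b
... | yes n<b = toWitness below n<b
... | no  n≮b = subst Q (ℕₚ.m+[n∸m]≡n (ℕₚ.≮⇒≥ n≮b)) (above (n ∸ b))

optimal? : ∀ n m d → Dec (Optimal n m d)
optimal? n m d = (d ℕ.≟ 0 ×-dec P n m ℚₚ.≟ frac 1 n) ⊎-dec (1 ≤? d ×-dec d ≤? n ℕ./ 2 ×-dec P n m ℚₚ.≟ val n m d)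

≤-by-slack : ∀ {a b} c → a + c ≡ b → a ≤ b
≤-by-slack {a} c refl = ℕₚ.m≤m+n a c

-- The denominator 12 k clears every fraction occurring in the rows m ≤ 4.
Row : ℕ → (ℕ → ℕ) → Set
Row m D = ∀ k → 1 ≤ k → P m k ≡ 1ℚ ℚ.- frac (D k) (12 * k)

val-of-row : ∀ {m D} → Row m D → ∀ {n a b} → a + b ≡ n → 1 ≤ a → 1 ≤ b → val n m a ≡ frac (D a + D b) (12 * n)
val-of-row {m} {D} row {a = suc a} {suc b} refl _ _ = begin
  val (suc a + suc b) m (suc a)
    ≡⟨ val-split m (suc a) (suc b) refl ⟩
  1ℚ ℚ.- mean (suc a) (suc b) (P m (suc a)) (P m (suc b))
    ≡⟨ cong₂ (λ x y → 1ℚ ℚ.- mean (suc a) (suc b) x y) (row (suc a) (s≤s z≤n)) (row (suc b) (s≤s z≤n)) ⟩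
  1ℚ ℚ.- mean (suc a) (suc b) (1ℚ ℚ.- x) (1ℚ ℚ.- y)
    ≡⟨ cong (λ z → 1ℚ ℚ.- z) (mean-1- a (suc b) x y) ⟩
  1ℚ ℚ.- (1ℚ ℚ.- mean (suc a) (suc b) x y)
    ≡⟨ solve 1 (λ z → con 1ℚ :- (con 1ℚ :- z) := z) refl (mean (suc a) (suc b) x y) ⟩
  mean (suc a) (suc b) x y
    ≡⟨ mean-frac a b (D (suc a)) (D (suc b)) ⟩
  frac (D (suc a) + D (suc b)) (12 * (suc a + suc b))
    ∎
  where
  open ≡-Reasoning; open +-*-Solver
  x = frac (D (suc a)) (12 * suc a)
  y = frac (D (suc b)) (12 * suc b)

-- By val-of-row a split is worth (D k + D (n − k)) / (12 n), which is largest when both parts reach t.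
column-of-row : ∀ {m D c t} → Row m D → (∀ k → D k ≤ c) → (∀ {k} → t ≤ k → D k ≡ c) → 6 ≤ c → 1 ≤ t →
                ∀ {n} → 2 + (t + t) ≤ n → P n m ≡ frac (c + c) (12 * n) × Optimal n m (nlt n)
column-of-row {m} {D} {c} {t} row D≤c D-saturates 6≤c 1≤t {suc n} 2+t+t≤n = P≡c+c , split-optimal split (trans P≡c+c (sym val≡c+c))
  where
  N = suc n
  d = nlt N
  t≤d : t ≤ d
  t≤d = nlt-lb t 2+t+t≤n
  split : Split N d
  split = ℕₚ.≤-trans 1≤t t≤d , proj₁ (nlt-half N)
  val-of-split : ∀ {k} → Split N k → val N m k ≡ frac (D k + D (N ∸ k)) (12 * N)
  val-of-split s@(1≤k , _) =
    val-of-row {m} {D} row (ℕₚ.m+[n∸m]≡n (ℕₚ.<⇒≤ (split⇒< s))) 1≤k (ℕₚ.≤-trans 1≤k (split⇒≤∸ s))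
  val≡c+c : val N m d ≡ frac (c + c) (12 * N)
  val≡c+c = trans (val-of-split split)
    (cong₂ (λ x y → frac (x + y) (12 * N)) (D-saturates t≤d) (D-saturates (ℕₚ.≤-trans t≤d (split⇒≤∸ split))))
  P≡c+c : P N m ≡ frac (c + c) (12 * N)
  P≡c+c = trans (P≡val split guess≤ vals≤) val≡c+c
    where
    guess≤ : frac 1 N ℚ.≤ val N m d
    guess≤ = subst (frac 1 N ℚ.≤_) (sym val≡c+c)
      (frac-≤ 1 n (c + c) _ (subst (_≤ (c + c) * N) (sym (ℕₚ.*-identityˡ (12 * N))) (ℕₚ.*-monoˡ-≤ N (ℕₚ.+-mono-≤ 6≤c 6≤c))))
    vals≤ : ∀ {k} → Split N k → val N m k ℚ.≤ val N m d
    vals≤ {k} s = subst₂ ℚ._≤_ (sym (val-of-split s)) (sym val≡c+c) (frac-mono-≤ _ (ℕₚ.+-mono-≤ (D≤c k) (D≤c (N ∸ k))))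

val-of-columns : ∀ {m} a b {A B} D → P (suc m) (suc a) ≡ frac A (12 * suc m) → P (suc m) b ≡ frac B (12 * suc m) →
                 suc a * A + b * B ≡ (suc a + b) * D → val (suc a + b) (suc m) (suc a) ≡ 1ℚ ℚ.- frac D (12 * suc m)
val-of-columns {m} a b {A} {B} D PA PB average = begin
  val (suc a + b) M (suc a)
    ≡⟨ val-split M (suc a) b refl ⟩
  1ℚ ℚ.- mean (suc a) b (P M (suc a)) (P M b)
    ≡⟨ cong₂ (λ x y → 1ℚ ℚ.- mean (suc a) b x y) PA PB ⟩
  1ℚ ℚ.- mean (suc a) b (frac A (12 * M)) (frac B (12 * M))
    ≡⟨ cong (λ z → 1ℚ ℚ.- z) (mean-frac-common a b A B (ℕ.pred (12 * M))) ⟩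
  1ℚ ℚ.- frac (suc a * A + b * B) ((suc a + b) * (12 * M))
    ≡⟨ cong (λ z → 1ℚ ℚ.- z) (frac-≡ (suc a * A + b * B) (ℕ.pred ((suc a + b) * (12 * M))) D (ℕ.pred (12 * M)) cross) ⟩
  1ℚ ℚ.- frac D (12 * M)
    ∎
  where
  open ≡-Reasoning
  M = suc m
  *-swap : ∀ x y z → x * y * z ≡ y * (x * z)
  *-swap x y z = ℕ-solve (x ∷ y ∷ z ∷ [])
  cross : (suc a * A + b * B) * (12 * M) ≡ D * ((suc a + b) * (12 * M))
  cross = trans (cong (_* (12 * M)) average) (*-swap (suc a + b) D (12 * M))

P[n,1] : ∀ n → 1 ≤ n → P n 1 ≡ frac 12 (12 * n)
P[n,1] (suc n) _ = trans (ℚₚ.≤-antisym (P-lub ℚₚ.≤-refl vals≤guess) (guess≤P n 1)) (frac-scale 11 1 n)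
  where
  vals≤guess : ∀ {k} → Split (suc n) k → val (suc n) 1 k ℚ.≤ frac 1 (suc n)
  vals≤guess {suc k} s = begin
    val (suc n) 1 (suc k)                   ≡⟨ val-split 1 (suc k) (suc n ∸ suc k) (ℕₚ.m+[n∸m]≡n (ℕₚ.<⇒≤ (split⇒< s))) ⟩
    1ℚ ℚ.- mean (suc k) (n ∸ k) 1ℚ 1ℚ        ≡⟨ cong (λ z → 1ℚ ℚ.- z) (mean-const k (n ∸ k) 1ℚ) ⟩
    1ℚ ℚ.- 1ℚ                                ≤⟨ 0≤frac 1 n ⟩
    frac 1 (suc n)                           ∎
    where open ℚₚ.≤-Reasoning

D₂ : ℕ → ℕ
D₂ 1 = 6
D₂ _ = 12

row₂ : Row 2 D₂
row₂ 1              _ = refl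
row₂ (suc (suc y)) _ = begin
  P 2 k                       ≡⟨ P-bellman 1 k ⟩
  val 2 k 1 ⊔ frac 1 2        ≡⟨ ℚₚ.p≥q⇒p⊔q≡p guess≤ ⟩
  val 2 k 1                   ≡⟨ val≡ ⟩
  1ℚ ℚ.- frac 12 (12 * k)     ∎
  where
  open ≡-Reasoning
  k = 2 + y
  val≡ : val 2 k 1 ≡ 1ℚ ℚ.- frac 12 (12 * k)
  val≡ = val-of-columns {1 + y} 0 1 {12} {12} 12 (P[n,1] k (s≤s z≤n)) (P[n,1] k (s≤s z≤n)) refl
  guess≤ : frac 1 2 ℚ.≤ val 2 k 1
  guess≤ = subst (frac 1 2 ℚ.≤_) (sym val≡) (frac≤1-frac 1 1 12 (ℕ.pred (12 * k)) slack)
    where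
    slack : 1 * (12 * (2 + y)) + 12 * 2 ≤ 2 * (12 * (2 + y))
    slack = ≤-by-slack (12 * y) (ℕ-solve (y ∷ []))

column₂ : ∀ {n} → 6 ≤ n → P n 2 ≡ frac 24 (12 * n) × Optimal n 2 (nlt n)
column₂ = column-of-row {t = 2} row₂ (computed-below (λ k → D₂ k ≤? 12) 2 (λ _ → ℕₚ.≤-refl))
                             (λ { (s≤s (s≤s _)) → refl }) (ℕₚ.m≤m+n 6 6) (s≤s z≤n)

P[n,2] : ∀ n → 4 ≤ n → P n 2 ≡ frac 24 (12 * n)
P[n,2] = computed-below (λ n → 4 ≤? n →-dec P n 2 ℚₚ.≟ frac 24 (12 * n)) 6 (λ z _ → proj₁ (column₂ (ℕₚ.m≤m+n 6 z)))

D₃ : ℕ → ℕ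
D₃ 1 = 8
D₃ 2 = 12
D₃ 3 = 16
D₃ _ = 20

row₃ : Row 3 D₃
row₃ 1                         _ = refl
row₃ 2                         _ = refl
row₃ 3                         _ = refl
row₃ (suc (suc (suc (suc y)))) _ = begin
  P 3 k                       ≡⟨ P-bellman 2 k ⟩
  val 3 k 1 ⊔ frac 1 3        ≡⟨ ℚₚ.p≥q⇒p⊔q≡p guess≤ ⟩
  val 3 k 1                   ≡⟨ val≡ ⟩
  1ℚ ℚ.- frac 20 (12 * k)     ∎
  where
  open ≡-Reasoning
  k = 4 + y
  val≡ : val 3 k 1 ≡ 1ℚ ℚ.- frac 20 (12 * k)
  val≡ = val-of-columns {3 + y} 0 2 {12} {24} 20 (P[n,1] k (s≤s z≤n)) (P[n,2] k (ℕₚ.m≤m+n 4 y)) refl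
  guess≤ : frac 1 3 ℚ.≤ val 3 k 1
  guess≤ = subst (frac 1 3 ℚ.≤_) (sym val≡) (frac≤1-frac 1 2 20 (ℕ.pred (12 * k)) slack)
    where
    slack : 1 * (12 * (4 + y)) + 20 * 3 ≤ 3 * (12 * (4 + y))
    slack = ≤-by-slack (36 + 24 * y) (ℕ-solve (y ∷ []))

column₃ : ∀ {n} → 10 ≤ n → P n 3 ≡ frac 40 (12 * n) × Optimal n 3 (nlt n)
column₃ = column-of-row {t = 4} row₃ (computed-below (λ k → D₃ k ≤? 20) 4 (λ _ → ℕₚ.≤-refl))
                             (λ { (s≤s (s≤s (s≤s (s≤s _)))) → refl }) (ℕₚ.m≤m+n 6 14) (s≤s z≤n)

P[n,3] : ∀ n → 8 ≤ n → P n 3 ≡ frac 40 (12 * n)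
P[n,3] = computed-below (λ n → 8 ≤? n →-dec P n 3 ℚₚ.≟ frac 40 (12 * n)) 10 (λ z _ → proj₁ (column₃ (ℕₚ.m≤m+n 10 z)))

D₄ : ℕ → ℕ
D₄ 1 = 9
D₄ 2 = 12
D₄ 3 = 18
D₄ 4 = 21
D₄ _ = 24

row₄ : Row 4 D₄
row₄ = computed-below (λ k → 1 ≤? k →-dec P 4 k ℚₚ.≟ 1ℚ ℚ.- frac (D₄ k) (12 * k)) 8 large
  where
  large : ∀ y → 1 ≤ 8 + y → P 4 (8 + y) ≡ 1ℚ ℚ.- frac 24 (12 * (8 + y))
  large y _ = begin
    P 4 k                                   ≡⟨ P-bellman 3 k ⟩
    val 4 k 1 ⊔ (val 4 k 2 ⊔ frac 1 4)      ≡⟨ cong (val 4 k 1 ⊔_) (ℚₚ.p≥q⇒p⊔q≡p guess≤) ⟩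
    val 4 k 1 ⊔ val 4 k 2                   ≡⟨ ℚₚ.p≤q⇒p⊔q≡q one≤two ⟩
    val 4 k 2                               ≡⟨ val₂ ⟩
    1ℚ ℚ.- frac 24 (12 * k)                 ∎
    where
    open ≡-Reasoning
    k = 8 + y
    val₁ : val 4 k 1 ≡ 1ℚ ℚ.- frac 33 (12 * k)
    val₁ = val-of-columns {7 + y} 0 3 {12} {40} 33 (P[n,1] k (s≤s z≤n)) (P[n,3] k (ℕₚ.m≤m+n 8 y)) refl
    val₂ : val 4 k 2 ≡ 1ℚ ℚ.- frac 24 (12 * k)
    val₂ = val-of-columns {7 + y} 1 2 {24} {24} 24 (P[n,2] k (ℕₚ.m≤m+n 4 (4 + y))) (P[n,2] k (ℕₚ.m≤m+n 4 (4 + y))) refl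
    guess≤ : frac 1 4 ℚ.≤ val 4 k 2
    guess≤ = subst (frac 1 4 ℚ.≤_) (sym val₂) (frac≤1-frac 1 3 24 (ℕ.pred (12 * k)) slack)
      where
      slack : 1 * (12 * (8 + y)) + 24 * 4 ≤ 4 * (12 * (8 + y))
      slack = ≤-by-slack (192 + 36 * y) (ℕ-solve (y ∷ []))
    one≤two : val 4 k 1 ℚ.≤ val 4 k 2
    one≤two = subst₂ ℚ._≤_ (sym val₁) (sym val₂) (p-r≤p-q 1ℚ (frac-mono-≤ (ℕ.pred (12 * k)) (ℕₚ.m≤m+n 24 9)))

column₄ : ∀ {n} → 12 ≤ n → P n 4 ≡ frac 48 (12 * n) × Optimal n 4 (nlt n)
column₄ = column-of-row {t = 5} row₄ (computed-below (λ k → D₄ k ≤? 24) 5 (λ _ → ℕₚ.≤-refl))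
                             (λ { (s≤s (s≤s (s≤s (s≤s (s≤s _))))) → refl }) (ℕₚ.m≤m+n 6 18) (s≤s z≤n)

R₄ : ℕ → ℕ
R₄ 1 = 12
R₄ 2 = 18
R₄ 3 = 21
R₄ 4 = 27
R₄ 5 = 30
R₄ 6 = 36
R₄ 7 = 39
R₄ 8 = 42
R₄ 9 = 45
R₄ _ = 48

P[n,4] : ∀ n → 1 ≤ n → P n 4 ≡ frac (R₄ n) (12 * n)
P[n,4] = computed-below (λ n → 1 ≤? n →-dec P n 4 ℚₚ.≟ frac (R₄ n) (12 * n)) 12 (λ z _ → proj₁ (column₄ (ℕₚ.m≤m+n 12 z)))

R₄≤48 : ∀ n → R₄ n ≤ 48
R₄≤48 = computed-below (λ n → R₄ n ≤? 48) 10 (λ _ → ℕₚ.≤-refl)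

R₄-saturated : ∀ {n} → 10 ≤ n → R₄ n ≡ 48
R₄-saturated (s≤s (s≤s (s≤s (s≤s (s≤s (s≤s (s≤s (s≤s (s≤s (s≤s _)))))))))) = refl

≤⇒≤12+z : ∀ {t} z → t ≤ 12 → t ≤ 12 + z
≤⇒≤12+z z t≤12 = ℕₚ.≤-trans t≤12 (ℕₚ.m≤m+n 12 z)

1<nlt[12+z] : ∀ z → 1 < nlt (12 + z)
1<nlt[12+z] z = nlt-lb 2 (≤⇒≤12+z z (ℕₚ.m≤m+n 6 6))

SOptimalNontrivial : ℕ → ℕ → Set
SOptimalNontrivial m n = 4 ≤ n → Optimal n m (S n m) × (¬ (n ≡ 4 × m ≡ 4) → 1 < S n m)

S-optimal-nontrivial? : ∀ m n → Dec (SOptimalNontrivial m n)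
S-optimal-nontrivial? m n = 4 ≤? n →-dec (optimal? n m (S n m) ×-dec (¬? (n ℕ.≟ 4 ×-dec m ℕ.≟ 4) →-dec 1 <? S n m))

-- From 12 on, S n m computes to nlt n and the column lemmas apply.
S-optimal-nontrivial : ∀ m → 2 ≤ m → m ≤ 4 → ∀ n → SOptimalNontrivial m n
S-optimal-nontrivial 2 _ _ =
  computed-below (S-optimal-nontrivial? 2) 12 (λ z _ → proj₂ (column₂ (≤⇒≤12+z z (ℕₚ.m≤m+n 6 6))) , λ _ → 1<nlt[12+z] z)
S-optimal-nontrivial 3 _ _ =
  computed-below (S-optimal-nontrivial? 3) 12 (λ z _ → proj₂ (column₃ (≤⇒≤12+z z (ℕₚ.m≤m+n 10 2))) , λ _ → 1<nlt[12+z] z)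
S-optimal-nontrivial 4 _ _ =
  computed-below (S-optimal-nontrivial? 4) 12 (λ z _ → proj₂ (column₄ (≤⇒≤12+z z ℕₚ.≤-refl)) , λ _ → 1<nlt[12+z] z)
S-optimal-nontrivial 0                             () _
S-optimal-nontrivial 1                             (s≤s ()) _
S-optimal-nontrivial (suc (suc (suc (suc (suc m))))) _ (s≤s (s≤s (s≤s (s≤s ()))))

nontrivial-optimal : ∀ {n m k} → Split (suc n) k → 1 < k → frac 1 (suc n) ℚ.≤ val (suc n) m k →
                    val (suc n) m 1 ℚ.≤ val (suc n) m k → ∃[ j ] (1 < j × Optimal (suc n) m j)
nontrivial-optimal {n} {m} {k} s 1<k guess≤ one≤ = from-attained (P-attained n m)
  where
  k-optimal : ∀ {x} → P (suc n) m ≡ x → x ℚ.≤ val (suc n) m k → ∃[ j ] (1 < j × Optimal (suc n) m j)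
  k-optimal P≡x x≤ = k , 1<k , split-optimal s (ℚₚ.≤-antisym (subst (ℚ._≤ val (suc n) m k) (sym P≡x) x≤) (val≤P s))
  from-attained : P (suc n) m ≡ frac 1 (suc n) ⊎ ∃[ j ] (Split (suc n) j × P (suc n) m ≡ val (suc n) m j) →
                  ∃[ j ] (1 < j × Optimal (suc n) m j)
  from-attained (inj₁ P≡guess)                    = k-optimal P≡guess guess≤
  from-attained (inj₂ (suc zero , _ , P≡one))      = k-optimal P≡one one≤
  from-attained (inj₂ (suc (suc j) , s′ , P≡val)) = suc (suc j) , s≤s (s≤s z≤n) , split-optimal s′ P≡val

two-split : ∀ t → Split (4 + t) 2
two-split t = s≤s z≤n , ℕₚ.m≤m+n 4 t

nontrivial-optimal-via-two : ∀ t m → 4 ≤ m → frac 36 (12 * m) ℚ.≤ P m (3 + t) → ∃[ k ] (1 < k × Optimal (4 + t) m k)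
nontrivial-optimal-via-two t (suc m) 4≤M 3/M≤ = nontrivial-optimal {3 + t} {suc m} {2} (two-split t) (s≤s (s≤s z≤n)) guess≤ one≤two
  where
  M = suc m
  N = 4 + t
  u = frac 12 (12 * M)
  u+u≡ : u ℚ.+ u ≡ frac 24 (12 * M)
  u+u≡ = frac-+-same 12 12 (ℕ.pred (12 * M))
  3u≤ : u ℚ.+ u ℚ.+ u ℚ.≤ P M (3 + t)
  3u≤ = subst (ℚ._≤ P M (3 + t)) (sym (trans (cong (ℚ._+ u) u+u≡) (frac-+-same 24 12 (ℕ.pred (12 * M))))) 3/M≤
  P[M,2]≤½ : P M 2 ℚ.≤ frac 1 2
  P[M,2]≤½ = subst (ℚ._≤ frac 1 2) (sym (P[n,2] M 4≤M))
    (frac-≤ 24 (ℕ.pred (12 * M)) 1 1 (subst (48 ≤_) (sym (ℕₚ.*-identityˡ (12 * M))) (ℕₚ.*-monoʳ-≤ 12 4≤M)))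
  one≤two : val N M 1 ℚ.≤ val N M 2
  one≤two = begin
    val N M 1
      ≡⟨ val-split M 1 (3 + t) refl ⟩
    1ℚ ℚ.- mean 1 (3 + t) (P M 1) (P M (3 + t))
      ≡⟨ cong (λ x → 1ℚ ℚ.- mean 1 (3 + t) x (P M (3 + t))) (P[n,1] M (s≤s z≤n)) ⟩
    1ℚ ℚ.- mean 1 (3 + t) u (P M (3 + t))
      ≤⟨ p-r≤p-q 1ℚ (mean-trade (2 + t) (P-monoʳ-≤ {M} {2 + t} {3 + t} (s≤s z≤n) (s≤s z≤n) (ℕₚ.n≤1+n _)) 3u≤) ⟩
    1ℚ ℚ.- mean 2 (2 + t) (u ℚ.+ u) (P M (2 + t))
      ≡⟨ cong (λ x → 1ℚ ℚ.- mean 2 (2 + t) x (P M (2 + t))) (trans u+u≡ (sym (P[n,2] M 4≤M))) ⟩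
    1ℚ ℚ.- mean 2 (2 + t) (P M 2) (P M (2 + t))
      ≡⟨ val-split M 2 (2 + t) refl ⟨
    val N M 2
      ∎
    where open ℚₚ.≤-Reasoning
  guess≤ : frac 1 N ℚ.≤ val N M 2
  guess≤ = begin
    frac 1 N
      ≡⟨ 1-frac {3 + t} {1} {3 + t} (ℕₚ.+-comm (3 + t) 1) ⟨
    1ℚ ℚ.- frac (3 + t) N
      ≡⟨ cong (λ x → 1ℚ ℚ.- x) (trans (sym (frac-+-same 1 (2 + t) (3 + t))) (cong₂ ℚ._+_ half-of-two (sym (ℚₚ.*-identityʳ _)))) ⟩
    1ℚ ℚ.- mean 2 (2 + t) (frac 1 2) 1ℚ
      ≤⟨ p-r≤p-q 1ℚ (mean-mono 1 (2 + t) P[M,2]≤½ (P≤1 m (2 + t))) ⟩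
    1ℚ ℚ.- mean 2 (2 + t) (P M 2) (P M (2 + t))
      ≡⟨ val-split M 2 (2 + t) refl ⟨
    val N M 2
      ∎
    where
    open ℚₚ.≤-Reasoning
    cross : 2 * 1 * (4 + t) ≡ 1 * ((4 + t) * 2)
    cross = ℕ-solve (t ∷ [])
    half-of-two : frac 1 N ≡ frac 2 N ℚ.* frac 1 2
    half-of-two = sym (trans (frac-* 2 (3 + t) 1 1) (frac-≡ (2 * 1) (ℕ.pred ((4 + t) * 2)) 1 (3 + t) cross))

P[7+y,3]≥3/[7+y] : ∀ y → frac 36 (12 * (7 + y)) ℚ.≤ P (7 + y) 3
P[7+y,3]≥3/[7+y] zero    = ℚₚ.≤-refl
P[7+y,3]≥3/[7+y] (suc y) = subst (frac 36 (12 * (8 + y)) ℚ.≤_) (sym (P[n,3] (8 + y) (ℕₚ.m≤m+n 8 y)))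
                                  (frac-mono-≤ (ℕ.pred (12 * (8 + y))) (ℕₚ.m≤m+n 36 4))

-- The bound P m (3 + t) ≥ 3/m comes from P 5 6 = 3/5, P 6 4 = 1/2 and P m 3 ≥ 3/m for m ≥ 7.
nontrivial-optimal-for-m≥5 : ∀ n m → 4 ≤ n → 5 ≤ m → ∃[ k ] (1 < k × Optimal n m k)
nontrivial-optimal-for-m≥5 (suc (suc (suc (suc t)))) (suc (suc (suc (suc (suc m))))) (s≤s (s≤s (s≤s (s≤s _))))
                           (s≤s (s≤s (s≤s (s≤s (s≤s _))))) = by-m t m
  where
  by-m : ∀ t m → ∃[ k ] (1 < k × Optimal (4 + t) (5 + m) k)
  by-m 0                   0 = 2 , s≤s (s≤s z≤n) , split-optimal {m = 5} (two-split 0) refl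
  by-m 1                   0 = 2 , s≤s (s≤s z≤n) , split-optimal {m = 5} (two-split 1) refl
  by-m 2                   0 = 2 , s≤s (s≤s z≤n) , split-optimal {m = 5} (two-split 2) refl
  by-m (suc (suc (suc t))) 0 = nontrivial-optimal-via-two (3 + t) 5 (ℕₚ.n≤1+n 4)
    (ℚₚ.≤-trans (ℚₚ.≤-reflexive {frac 36 (12 * 5)} {P 5 6} refl)
                (P-monoʳ-≤ {5} {6} {6 + t} (s≤s z≤n) (s≤s z≤n) (ℕₚ.m≤m+n 6 t)))
  by-m 0                   1 = 2 , s≤s (s≤s z≤n) , split-optimal {m = 6} (two-split 0) refl
  by-m (suc t)             1 = nontrivial-optimal-via-two (suc t) 6 (ℕₚ.m≤m+n 4 2)
    (ℚₚ.≤-trans (ℚₚ.≤-reflexive (sym (P[n,4] 6 (s≤s z≤n))))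
                (P-monoʳ-≤ {6} {4} {4 + t} (s≤s z≤n) (s≤s z≤n) (ℕₚ.m≤m+n 4 t)))
  by-m t (suc (suc y))       = nontrivial-optimal-via-two t (7 + y) (ℕₚ.m≤m+n 4 (3 + y))
    (ℚₚ.≤-trans (P[7+y,3]≥3/[7+y] y)
                (P-monoʳ-≤ {7 + y} {3} {3 + t} (s≤s z≤n) (s≤s z≤n) (ℕₚ.m≤m+n 3 t)))

Pmix-column : ∀ {m} {R : ℕ → ℕ} → (∀ n → 1 ≤ n → P n m ≡ frac (R n) (12 * n)) →
              ∀ {a b} → 1 ≤ a → 1 ≤ b → Pmix a b m ≡ frac (R a + R b) (12 * (a + b))
Pmix-column {m} {R} column {suc a} {suc b} _ _ =
  trans (cong₂ (mean (suc a) (suc b)) (column (suc a) (s≤s z≤n)) (column (suc b) (s≤s z≤n))) (mean-frac a b (R (suc a)) (R (suc b)))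

Pmix₄-≤ : ∀ {a b c d} → 1 ≤ a → 1 ≤ b → 1 ≤ c → 1 ≤ d → c + d ≡ a + b →
          R₄ a + R₄ b ≤ R₄ c + R₄ d → Pmix a b 4 ℚ.≤ Pmix c d 4
Pmix₄-≤ {suc a} {b} {c} {d} 1≤a 1≤b 1≤c 1≤d c+d≡a+b R≤R = begin
  Pmix (suc a) b 4                            ≡⟨ Pmix-column {4} {R₄} P[n,4] 1≤a 1≤b ⟩
  frac (R₄ (suc a) + R₄ b) (12 * (suc a + b))
    ≤⟨ frac-mono-≤ {R₄ (suc a) + R₄ b} {R₄ c + R₄ d} (ℕ.pred (12 * (suc a + b))) R≤R ⟩
  frac (R₄ c + R₄ d) (12 * (suc a + b))       ≡⟨ cong (λ x → frac (R₄ c + R₄ d) (12 * x)) c+d≡a+b ⟨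
  frac (R₄ c + R₄ d) (12 * (c + d))           ≡⟨ Pmix-column {4} {R₄} P[n,4] 1≤c 1≤d ⟨
  Pmix c d 4                                  ∎
  where open ℚₚ.≤-Reasoning

NltDominates₄ : ℕ → ℕ → Set
NltDominates₄ k N = 2 * k ≤ N → R₄ k + R₄ (N ∸ k) ≤ R₄ (nlt N) + R₄ (N ∸ nlt N)

nlt-dominates₄? : ∀ k N → Dec (NltDominates₄ k N)
nlt-dominates₄? k N = 2 * k ≤? N →-dec R₄ k + R₄ (N ∸ k) ≤? R₄ (nlt N) + R₄ (N ∸ nlt N)

nlt-dominates₄-above-22 : ∀ k z → NltDominates₄ k (22 + z)
nlt-dominates₄-above-22 k z _ =
  subst₂ (λ x y → R₄ k + R₄ (N ∸ k) ≤ x + y) (sym (R₄-saturated 10≤d)) (sym (R₄-saturated 10≤N-d))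
         (ℕₚ.+-mono-≤ (R₄≤48 k) (R₄≤48 (N ∸ k)))
  where
  N = 22 + z
  10≤d : 10 ≤ nlt N
  10≤d = nlt-lb 10 (ℕₚ.m≤m+n 22 z)
  10≤N-d : 10 ≤ N ∸ nlt N
  10≤N-d = ℕₚ.≤-trans 10≤d (ℕₚ.m+n≤o⇒m≤o∸n (nlt N) (proj₁ (nlt-half N)))

Pmix₄≤Pmix₄-at-nlt : ∀ k → 2 ≤ k → (∀ N → NltDominates₄ k N) →
                     ∀ N → 2 * k ≤ N → Pmix k (N ∸ k) 4 ℚ.≤ Pmix (nlt N) (N ∸ nlt N) 4
Pmix₄≤Pmix₄-at-nlt k 2≤k balanced N 2k≤N =
  Pmix₄-≤ 1≤k (ℕₚ.≤-trans 1≤k (ℕₚ.m+n≤o⇒m≤o∸n k k+k≤N)) 1≤d (ℕₚ.≤-trans 1≤d (ℕₚ.m+n≤o⇒m≤o∸n d d+d≤N))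
          (trans (ℕₚ.m+[n∸m]≡n (ℕₚ.m+n≤o⇒m≤o d d+d≤N)) (sym (ℕₚ.m+[n∸m]≡n (ℕₚ.m+n≤o⇒m≤o k k+k≤N))))
          (balanced N 2k≤N)
  where
  d = nlt N
  1≤k : 1 ≤ k
  1≤k = ℕₚ.≤-trans (ℕₚ.n≤1+n 1) 2≤k
  k+k≤N : k + k ≤ N
  k+k≤N = subst (_≤ N) (trans (ℕₚ.*-comm 2 k) (sym (k+k≡k*2 k))) 2k≤N
  d+d≤N : d + d ≤ N
  d+d≤N = proj₁ (nlt-half N)
  1≤d : 1 ≤ d
  1≤d = nlt-lb 1 (ℕₚ.≤-trans (ℕₚ.+-mono-≤ 2≤k 2≤k) k+k≤N)

lemma1p5 : (∀ n m → 4 ≤ n → 2 ≤ m → ¬ (n ≡ 4 × m ≡ 4) → ∃[ k ] (1 < k × Optimal n m k))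
    × (∀ n m → 4 ≤ n → 2 ≤ m → m ≤ 4 → Optimal n m (S n m))
    × (∀ k → (k ≡ 4 ⊎ k ≡ 6 ⊎ k ≡ 10) → ∀ N → 2 * k ≤ N →
    Pmix k (N ∸ k) 4 ≤ℚ Pmix (nlt N) (N ∸ nlt N) 4)
lemma1p5 = part-i , part-ii , part-iii
  where
  part-ii : ∀ n m → 4 ≤ n → 2 ≤ m → m ≤ 4 → Optimal n m (S n m)
  part-ii n m 4≤n 2≤m m≤4 = proj₁ (S-optimal-nontrivial m 2≤m m≤4 n 4≤n)
  part-i : ∀ n m → 4 ≤ n → 2 ≤ m → ¬ (n ≡ 4 × m ≡ 4) → ∃[ k ] (1 < k × Optimal n m k)
  part-i n m 4≤n 2≤m n,m≢4,4 with m ≤? 4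
  ... | yes m≤4 = S n m , proj₂ (S-optimal-nontrivial m 2≤m m≤4 n 4≤n) n,m≢4,4 , part-ii n m 4≤n 2≤m m≤4
  ... | no m≰4 = nontrivial-optimal-for-m≥5 n m 4≤n (ℕₚ.≰⇒> m≰4)
  part-iii : ∀ k → (k ≡ 4 ⊎ k ≡ 6 ⊎ k ≡ 10) → ∀ N → 2 * k ≤ N → Pmix k (N ∸ k) 4 ≤ℚ Pmix (nlt N) (N ∸ nlt N) 4
  part-iii .4  (inj₁ refl)        =
    Pmix₄≤Pmix₄-at-nlt 4 (ℕₚ.m≤m+n 2 2) (computed-below (nlt-dominates₄? 4) 22 (nlt-dominates₄-above-22 4))
  part-iii .6  (inj₂ (inj₁ refl)) =
    Pmix₄≤Pmix₄-at-nlt 6 (ℕₚ.m≤m+n 2 4) (computed-below (nlt-dominates₄? 6) 22 (nlt-dominates₄-above-22 6))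
  part-iii .10 (inj₂ (inj₂ refl)) =
    Pmix₄≤Pmix₄-at-nlt 10 (ℕₚ.m≤m+n 2 8) (computed-below (nlt-dominates₄? 10) 22 (nlt-dominates₄-above-22 10))
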